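{- If $T$ is a tree such that $\operatorname{svs}(T)\ge 2$, then $\operatorname{svs}(T)\le \mathfrak{H}(T)$.
   Context: A weak homomorphism $f:G\to H$ is a map $f:V(G)\to V(H)$ such that for every edge $uv\in E(G)$, either $f(u)f(v)\in E(H)$ or $f(u)=f(v)$; it is surjective if $f(V(G))=V(H)$. For weak homomorphisms $f,g:G\to H$, $m_G(f,g)=\min\{d_H(f(u),g(u))\mid u\in V(G)\}$. For a connected graph $H$, the strong vertex span is $\operatorname{svs}(H)=\max\{m_P(f,g)\mid P \text{ is a path and } f,g:P\to H \text{ are surjective weak homomorphisms}\}$. For a vertex $v$ of a tree $T$, the components of $T-\{v\}$ are its maximal connected subgraphs; for such a component $C(v)$, $\operatorname{reach}(C(v))=\max\{d(v,u)\mid u\in V(C(v))\cup\{v\}\}$. Denote the components of $T-\{v\}$ by $C_1(v),\dots,C_{\deg(v)}(v)$ with $\operatorname{reach}(C_i(v))\ge\operatorname{reach}(C_{i+1}(v))$. The triod size of $v$ is $\eta(v)=\operatorname{reach}(C_3(v))$ if $\deg(v)\ge 3$ and $\eta(v)=0$ if $\deg(v)\le 2$; the triod size of $T$ is $\mathfrak{H}(T)=\max\{\eta(v)\mid v\in V(T)\}$. -}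

module Defs where

open import Data.Nat using (ℕ; zero; suc; _⊔_; _⊓_; _≤_; _≡ᵇ_)
open import Data.Nat.Properties using (≤-decTotalOrder)
open import Data.Fin using (Fin; zero; suc; toℕ; inject₁; fromℕ; _≟_)
open import Data.Bool using (Bool; true; false; _∧_; _∨_; not; if_then_else_)
open import Data.Bool.ListAction using (any)
open import Data.List using (List; []; _∷_; map; foldr; allFin; upTo; filterᵇ; reverse)
open import Data.Product using (Σ; ∃; _×_; _,_)
open import Data.Sum using (_⊎_)
open import Function using (_∘_)
open import Relation.Nullary using (¬_; does)
open import Relation.Binary.PropositionalEquality using (_≡_; refl; cong)
open import Data.Bool.Properties using (∨-comm)
import Data.List.Sort.InsertionSort.Base as Sort

record Graph : Set where
  field
    n      : ℕ
    E      : Fin n → Fin n → Bool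
    E-sym  : ∀ x y → E x y ≡ E y x
    irrefl : ∀ x → E x x ≡ false
open Graph public

hasWalk : ∀ {n} → (Fin n → Fin n → Bool) → ℕ → Fin n → Fin n → Bool
hasWalk         Ed zero    x y = does (x ≟ y)
hasWalk {n = n} Ed (suc k) x y = any (λ z → Ed x z ∧ hasWalk Ed k z y) (allFin n)

-- d_G(x,y): the least k with a walk of length k from x to y
-- (searching k = 0..n; returns n if none, which never happens in a
-- connected graph since shortest walks have length < n).
dist : (G : Graph) → Fin (n G) → Fin (n G) → ℕ
dist G x y = foldr (λ k acc → if hasWalk (E G) k x y then k else acc) (n G) (upTo (suc (n G)))

Connected : Graph → Set
Connected G = ∀ x y → ∃ λ k → hasWalk (E G) k x y ≡ true

record Cycle (G : Graph) : Set where
  field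
    k     : ℕ
    c     : Fin (suc (suc (suc k))) → Fin (n G)
    inj   : ∀ i j → c i ≡ c j → i ≡ j
    steps : ∀ (i : Fin (suc (suc k))) → E G (c (inject₁ i)) (c (suc i)) ≡ true
    close : E G (c (fromℕ (suc (suc k)))) (c zero) ≡ true

Acyclic : Graph → Set
Acyclic G = ¬ Cycle G

IsTree : Graph → Set
IsTree G = (1 ≤ n G) × Connected G × Acyclic G

-- Path graphs: P m has vertices 0,1,…,m and edges i(i+1).

pathE : ∀ m → Fin (suc m) → Fin (suc m) → Bool
pathE m i j = (suc (toℕ i) ≡ᵇ toℕ j) ∨ (suc (toℕ j) ≡ᵇ toℕ i)

private
  sucᵇ-irr : ∀ a → (suc a ≡ᵇ a) ≡ false
  sucᵇ-irr zero    = refl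
  sucᵇ-irr (suc a) = sucᵇ-irr a

PathGraph : ℕ → Graph
PathGraph m = record
  { n      = suc m
  ; E      = pathE m
  ; E-sym  = λ i j → ∨-comm (suc (toℕ i) ≡ᵇ toℕ j) (suc (toℕ j) ≡ᵇ toℕ i)
  ; irrefl = λ i → cong (λ b → b ∨ b) (sucᵇ-irr (toℕ i))
  }

WeakHom : (G H : Graph) → (Fin (n G) → Fin (n H)) → Set
WeakHom G H f = ∀ u v → E G u v ≡ true → (f u ≡ f v) ⊎ (E H (f u) (f v) ≡ true)

Surjective : ∀ {a b} → (Fin a → Fin b) → Set
Surjective {b = b} f = ∀ (y : Fin b) → ∃ λ x → f x ≡ y

minFin : ∀ {k} → (Fin (suc k) → ℕ) → ℕ
minFin {zero}  h = h zero
minFin {suc k} h = h zero ⊓ minFin (h ∘ suc)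

mP : ∀ m (H : Graph) → (f g : Fin (suc m) → Fin (n H)) → ℕ
mP m H f g = minFin (λ u → dist H (f u) (g u))

-- Strong vertex span, as a predicate "s = svs(H)" (svs is a maximum
-- over the infinitely many paths P, so it is given relationally):
-- s is attained by some path and surjective weak homomorphisms, and
-- bounds m_P(f,g) for all of them.

IsSvs : Graph → ℕ → Set
IsSvs H s =
  (Σ ℕ λ m → Σ (Fin (suc m) → Fin (n H)) λ f → Σ (Fin (suc m) → Fin (n H)) λ g →
     WeakHom (PathGraph m) H f × Surjective f ×
     WeakHom (PathGraph m) H g × Surjective g × mP m H f g ≡ s)
  × (∀ m (f g : Fin (suc m) → Fin (n H)) →
       WeakHom (PathGraph m) H f → Surjective f →
       WeakHom (PathGraph m) H g → Surjective g → mP m H f g ≤ s)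

maxList : List ℕ → ℕ
maxList = foldr _⊔_ 0

-- reachability from w to u in G - {v}: a walk of length < n avoiding v
-- (edges incident to v are deleted)
reachAvoid : (G : Graph) → (v w u : Fin (n G)) → Bool
reachAvoid G v w u = any (λ k → hasWalk E' k w u) (upTo (n G))
  where
    E' : Fin (n G) → Fin (n G) → Bool
    E' a b = E G a b ∧ not (does (a ≟ v)) ∧ not (does (b ≟ v))

neighbours : (G : Graph) → Fin (n G) → List (Fin (n G))
neighbours G v = filterᵇ (E G v) (allFin (n G))

-- reach(C(v)) for the component C(v) of G - {v} containing the
-- neighbour w of v:  max { d(v,u) | u ∈ V(C(v)) ∪ {v} }
reach : (G : Graph) → (v w : Fin (n G)) → ℕ
reach G v w = maxList (map (λ u → if reachAvoid G v w u then dist G v u else 0) (allFin (n G)))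

sortDesc : List ℕ → List ℕ
sortDesc xs = reverse (Sort.sort ≤-decTotalOrder xs)

nth0 : ℕ → List ℕ → ℕ
nth0 _       []       = 0
nth0 zero    (x ∷ _)  = x
nth0 (suc i) (_ ∷ xs) = nth0 i xs

-- η(v) = reach(C_3(v)) if deg v ≥ 3, else 0.  (The list of reaches of
-- the components of T - {v}, one per neighbour, sorted non-increasingly;
-- its third entry, or 0 if there are fewer than three.)
eta : (G : Graph) → Fin (n G) → ℕ
eta G v = nth0 2 (sortDesc (map (reach G v) (neighbours G v)))

triodSize : Graph → ℕ
triodSize G = maxList (map (eta G) (allFin (n G)))

{-# OPTIONS --safe #-}
-- Let f, g : P → T be surjective weak homomorphisms with d(f t, g t) ≥ s ≥ 2
-- for all t, fix a vertex p and let r be a vertex farthest from p. If z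
-- separates u from p then d(u,p) = d(u,z) + d(z,p), so d(z,r) ≥ d(z,u);
-- hence if z separates two vertices at distance ≥ s from it, d(z,r) ≥ s too.
--
-- Say that time t separates if f t separates g t from r. This holds when f
-- visits r and fails when g does; say f visits r first, and let ta be the last
-- separating time before g visits r. The pivot f ta is adjacent to
-- x₁ = f (ta + 1), and x₁ does not separate g (ta + 1) from r, while the pivot
-- does; as T has no cycles, x₁ lies neither in the branch of g (ta + 1) nor in
-- that of r at the pivot. Afterwards f cannot return to the pivot without
-- separating again, so it stays in the branch of x₁, whereas g has to pass the
-- pivot to reach r. When g stands on the pivot, g ta, the position of f and r
-- lie in three different branches at distance ≥ s, so η(pivot) ≥ s.

module Submission where

open import Defs
open import Data.Bool using (Bool; true; false; _∧_; not; if_then_else_)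
open import Data.Bool.Properties using (T-≡; ∧-comm)
import Data.Bool as Bool
open import Data.Bool.ListAction using (any)
open import Data.Fin using (Fin; zero; suc; toℕ; fromℕ; fromℕ<; inject₁; _≟_)
open import Data.Fin.Properties using (toℕ-injective; toℕ-fromℕ<; toℕ<n; injective⇒≤)
open import Data.List using (List; []; _∷_; _++_; foldr; map; filter; applyUpTo; upTo; allFin; length; reverse)
open import Data.List.Extrema.Nat using (argmax; f[xs]≤f[argmax])
open import Data.List.Membership.Propositional using (_∈_; lose; find)
open import Data.List.Membership.Propositional.Properties using (∈-allFin; ∈-map⁺; ∈-filter⁺; ∈-upTo⁺)
open import Data.List.Membership.Setoid.Properties using (index-injective)
open import Data.List.Properties using (filter-++; filter-all; filter-none; length-reverse; reverse-++)
open import Data.List.Relation.Binary.Permutation.Propositional.Properties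
  using (filter-↭; ↭-length; ↭-reverse; All-resp-↭)
open import Data.List.Relation.Binary.Permutation.Propositional using (↭-sym)
open import Data.List.Relation.Unary.All as All using (All; []; _∷_)
open import Data.List.Relation.Unary.Any using (here; there)
open import Data.List.Relation.Unary.Any.Properties using (any⁺; any⁻)
open import Data.List.Relation.Unary.Linked as Linked using (Linked)
open import Data.List.Relation.Unary.Linked.Properties using (Linked⇒All)
open import Data.Nat using (ℕ; zero; suc; _+_; _∸_; _≤_; _<_; _⊓_; z≤n; s≤s; s≤s⁻¹; _≤?_; _<?_)
open import Data.Nat.Properties hiding (_≟_)
open import Data.List.Sort.InsertionSort.Base ≤-decTotalOrder using (sort)
open import Data.List.Sort.InsertionSort.Properties ≤-decTotalOrder using (sort-↭; sort-↗)
open import Data.Product using (∃; ∃₂; _×_; _,_; proj₁; proj₂)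
open import Data.Sum using (_⊎_; inj₁; inj₂; [_,_]′)
open import Function using (_∘_; id; Injective; Equivalence)
open import Level using (0ℓ)
open import Relation.Binary.PropositionalEquality
open import Relation.Binary using (tri<; tri≈; tri>)
open import Relation.Nullary using (¬_; Dec; yes; no; does; ¬?; contradiction)
open import Relation.Nullary.Decidable using (map′; decidable-stable)
open import Relation.Unary using (Pred; Decidable)

private
  variable
    A : Set
    N k l m : ℕ

-- Lists and searches

∧-≡true : ∀ {x y} → x ∧ y ≡ true → x ≡ true × y ≡ true
∧-≡true {true} {true} _ = refl , refl

any-≡true⁺ : (p : A → Bool) {x : A} {xs : List A} → x ∈ xs → p x ≡ true → any p xs ≡ true
any-≡true⁺ p x∈xs px = Equivalence.to T-≡ (any⁺ p (lose x∈xs (Equivalence.from T-≡ px)))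

any-≡true⁻ : (p : A → Bool) (xs : List A) → any p xs ≡ true → ∃ λ x → x ∈ xs × p x ≡ true
any-≡true⁻ p xs any≡true with find (any⁻ p xs (Equivalence.from T-≡ any≡true))
... | x , x∈xs , px = x , x∈xs , Equivalence.to T-≡ px

maxList-upper : ∀ {x xs} → x ∈ xs → x ≤ maxList xs
maxList-upper {xs = y ∷ ys} (here refl)  = m≤m⊔n y (maxList ys)
maxList-upper {xs = y ∷ ys} (there x∈ys) = ≤-trans (maxList-upper x∈ys) (m≤n⊔m y (maxList ys))

minFin-lower : (h : Fin (suc k) → ℕ) (i : Fin (suc k)) → minFin h ≤ h i
minFin-lower {zero}  h zero    = ≤-refl
minFin-lower {suc k} h zero    = m⊓n≤m (h zero) (minFin (h ∘ suc))
minFin-lower {suc k} h (suc i) = ≤-trans (m⊓n≤n (h zero) (minFin (h ∘ suc))) (minFin-lower (h ∘ suc) i)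

distinct-members⇒≤length : {xs : List A} (w : Fin k → A) → Injective _≡_ _≡_ w → (∀ i → w i ∈ xs) → k ≤ length xs
distinct-members⇒≤length {A = A} w w-injective w∈xs =
  injective⇒≤ λ same-index → w-injective (index-injective (setoid A) (w∈xs _) (w∈xs _) same-index)

triple : A → A → A → Fin 3 → A
triple a b c zero             = a
triple a b c (suc zero)       = b
triple a b c (suc (suc zero)) = c

triple-injective : {a b c : A} → a ≢ b → a ≢ c → b ≢ c → Injective _≡_ _≡_ (triple a b c)
triple-injective a≢b a≢c b≢c {zero}             {zero}             _  = refl
triple-injective a≢b a≢c b≢c {zero}             {suc zero}         eq = contradiction eq a≢b
triple-injective a≢b a≢c b≢c {zero}             {suc (suc zero)}   eq = contradiction eq a≢c
triple-injective a≢b a≢c b≢c {suc zero}         {zero}             eq = contradiction (sym eq) a≢b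
triple-injective a≢b a≢c b≢c {suc zero}         {suc zero}         _  = refl
triple-injective a≢b a≢c b≢c {suc zero}         {suc (suc zero)}   eq = contradiction eq b≢c
triple-injective a≢b a≢c b≢c {suc (suc zero)}   {zero}             eq = contradiction (sym eq) a≢c
triple-injective a≢b a≢c b≢c {suc (suc zero)}   {suc zero}         eq = contradiction (sym eq) b≢c
triple-injective a≢b a≢c b≢c {suc (suc zero)}   {suc (suc zero)}   _  = refl

length-filter-map : ∀ {P : Pred ℕ 0ℓ} (P? : Decidable P) (h : A → ℕ) xs →
                    length (filter P? (map h xs)) ≡ length (filter (P? ∘ h) xs)
length-filter-map P? h []       = refl
length-filter-map P? h (x ∷ xs) with does (P? (h x))
... | true  = cong suc (length-filter-map P? h xs)
... | false = length-filter-map P? h xs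

ascending-split : ∀ s {ys} → Linked _≤_ ys →
                  ∃₂ λ lo hi → ys ≡ lo ++ hi × All (λ y → ¬ s ≤ y) lo × All (s ≤_) hi
ascending-split s {[]}     _   = [] , [] , refl , [] , []
ascending-split s {y ∷ ys} ys↗ with s ≤? y
... | yes s≤y = [] , y ∷ ys , refl , [] , Linked⇒All ≤-trans s≤y ys↗
... | no  s≰y with ascending-split s (Linked.tail ys↗)
...   | lo , hi , refl , lo<s , s≤hi = y ∷ lo , hi , refl , s≰y ∷ lo<s , s≤hi

third-of-++ : ∀ {P : ℕ → Set} {xs} ys → All P xs → 3 ≤ length xs → P (nth0 2 (xs ++ ys))
third-of-++ {xs = _ ∷ _ ∷ _ ∷ _} _ (_ ∷ _ ∷ p ∷ _) _ = p
third-of-++ {xs = []}            _ _ ()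
third-of-++ {xs = _ ∷ []}        _ _ (s≤s ())
third-of-++ {xs = _ ∷ _ ∷ []}    _ _ (s≤s (s≤s ()))

third-largest : ∀ s xs → 3 ≤ length (filter (s ≤?_) xs) → s ≤ nth0 2 (sortDesc xs)
third-largest s xs 3≤#xs with ascending-split s (sort-↗ xs)
... | lo , hi , sort≡lo++hi , lo<s , s≤hi =
  subst (λ ys → s ≤ nth0 2 ys) (sym sortDesc≡)
    (third-of-++ (reverse lo) (All-resp-↭ (↭-sym (↭-reverse hi)) s≤hi) 3≤#hi)
  where
    sortDesc≡ : sortDesc xs ≡ reverse hi ++ reverse lo
    sortDesc≡ = trans (cong reverse sort≡lo++hi) (reverse-++ lo hi)

    #sort≡#hi : length (filter (s ≤?_) (sort xs)) ≡ length (reverse hi)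
    #sort≡#hi = begin
      length (filter (s ≤?_) (sort xs))                 ≡⟨ cong (length ∘ filter (s ≤?_)) sort≡lo++hi ⟩
      length (filter (s ≤?_) (lo ++ hi))                ≡⟨ cong length (filter-++ (s ≤?_) lo hi) ⟩
      length (filter (s ≤?_) lo ++ filter (s ≤?_) hi)   ≡⟨ cong₂ (λ l h → length (l ++ h)) (filter-none (s ≤?_) lo<s) (filter-all (s ≤?_) s≤hi) ⟩
      length hi                                         ≡⟨ length-reverse hi ⟨
      length (reverse hi)                               ∎
      where open ≡-Reasoning

    3≤#hi : 3 ≤ length (reverse hi)
    3≤#hi = subst (3 ≤_) (trans (↭-length (filter-↭ (s ≤?_) (↭-sym (sort-↭ xs)))) #sort≡#hi) 3≤#xs

searchFirst : (ℕ → Bool) → ℕ → List ℕ → ℕ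
searchFirst p default = foldr (λ k found → if p k then k else found) default

searchFirst-hit : ∀ p default (f : ℕ → ℕ) L {i} → i < L → p (f i) ≡ true →
  ∃ λ j → j ≤ i × searchFirst p default (applyUpTo f L) ≡ f j × p (f j) ≡ true × (∀ {j′} → j′ < j → p (f j′) ≡ false)
searchFirst-hit p default f (suc L) {i} i<L pfi with p (f 0) in pf0
... | true = 0 , z≤n , refl , pf0 , λ ()
searchFirst-hit p default f (suc L) {zero}  _          pfi | false = contradiction (trans (sym pf0) pfi) λ ()
searchFirst-hit p default f (suc L) {suc i} (s≤s i<L) pfi | false
  with searchFirst-hit p default (f ∘ suc) L i<L pfi
... | j , j≤i , found , pfj , misses =
  suc j , s≤s j≤i , found , pfj , λ { {zero} _ → pf0 ; {suc j′} (s≤s j′<j) → misses j′<j }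

lastBefore : ∀ {P : Pred ℕ 0ℓ} → Decidable P → ∀ {t₀ t₁} → P t₀ → ¬ P t₁ → t₀ ≤ t₁ →
             ∃ λ t → t < t₁ × P t × (∀ {u} → t < u → u ≤ t₁ → ¬ P u)
lastBefore P? {t₁ = zero} p ¬p z≤n = contradiction p ¬p
lastBefore {P = P} P? {t₀} {suc t₁} p ¬p t₀≤t₁+1 with P? t₁
... | yes pt₁ = t₁ , ≤-refl , pt₁ , λ t₁<u u≤t₁+1 → subst (¬_ ∘ P) (sym (≤-antisym u≤t₁+1 t₁<u)) ¬p
... | no ¬pt₁ with lastBefore P? p ¬pt₁ (s≤s⁻¹ (≤∧≢⇒< t₀≤t₁+1 λ t₀≡ → ¬p (subst P t₀≡ p)))
...   | t , t<t₁ , pt , after = t , m<n⇒m<1+n t<t₁ , pt , after′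
  where
    after′ : ∀ {u} → t < u → u ≤ suc t₁ → ¬ P u
    after′ t<u u≤t₁+1 with m≤n⇒m<n∨m≡n u≤t₁+1
    ... | inj₁ u<t₁+1 = after t<u (s≤s⁻¹ u<t₁+1)
    ... | inj₂ refl   = ¬p

-- Walks

BoolRel : ℕ → Set
BoolRel N = Fin N → Fin N → Bool

private
  variable
    H H′ : BoolRel N
    a b c u v z : Fin N

infixr 5 _◅_ _◅◅_

data Walk {N} (H : BoolRel N) : Fin N → Fin N → ℕ → Set where
  ε   : ∀ {a} → Walk H a a 0
  _◅_ : ∀ {a b c k} → H a b ≡ true → Walk H b c k → Walk H a c (suc k)

Reachable : BoolRel N → Fin N → Fin N → Set
Reachable H a b = ∃ (Walk H a b)

_◅◅_ : Walk H a b k → Walk H b c l → Walk H a c (k + l)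
ε       ◅◅ w′ = w′
(e ◅ w) ◅◅ w′ = e ◅ (w ◅◅ w′)

_▻_ : Walk H a b k → H b c ≡ true → Walk H a c (suc k)
ε        ▻ e = e ◅ ε
(e′ ◅ w) ▻ e = e′ ◅ (w ▻ e)

reverseʷ : (∀ x y → H x y ≡ H y x) → Walk H a b k → Walk H b a k
reverseʷ         H-sym ε                 = ε
reverseʷ {H = H} H-sym (_◅_ {a} {b} e w) = reverseʷ H-sym w ▻ trans (H-sym b a) e

mapʷ : (∀ {x y} → H x y ≡ true → H′ x y ≡ true) → Walk H a b k → Walk H′ a b k
mapʷ H⊆H′ ε       = ε
mapʷ H⊆H′ (e ◅ w) = H⊆H′ e ◅ mapʷ H⊆H′ w

hasWalk⇒Walk : ∀ k a b → hasWalk H k a b ≡ true → Walk H a b k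
hasWalk⇒Walk zero a b found with a ≟ b
... | yes refl = ε
hasWalk⇒Walk zero a b () | no _
hasWalk⇒Walk {H = H} (suc k) a b found
  with any-≡true⁻ (λ c → H a c ∧ hasWalk H k c b) (allFin _) found
... | c , _ , step = let (a—c , rest) = ∧-≡true step in a—c ◅ hasWalk⇒Walk k c b rest

Walk⇒hasWalk : Walk H a b k → hasWalk H k a b ≡ true
Walk⇒hasWalk {a = a} ε with a ≟ a
... | yes _  = refl
... | no a≢a = contradiction refl a≢a
Walk⇒hasWalk {H = H} {b = c} (_◅_ {a} {b} {k = k} a—b w) =
  any-≡true⁺ (λ b → H a b ∧ hasWalk H k b c) (∈-allFin b) (cong₂ _∧_ a—b (Walk⇒hasWalk w))

vertex : ∀ {N} {H : BoolRel N} {a b k} → Walk H a b k → Fin (suc k) → Fin N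
vertex {a = a} _ zero    = a
vertex (_ ◅ w)   (suc i) = vertex w i

vertex-step : (w : Walk H a b k) (i : Fin k) → H (vertex w (inject₁ i)) (vertex w (suc i)) ≡ true
vertex-step (e ◅ w) zero    = e
vertex-step (e ◅ w) (suc i) = vertex-step w i

vertex-last : (w : Walk H a b k) → vertex w (fromℕ k) ≡ b
vertex-last ε       = refl
vertex-last (_ ◅ w) = vertex-last w

take : (w : Walk H a b k) (i : Fin (suc k)) → Walk H a (vertex w i) (toℕ i)
take w       zero    = ε
take (e ◅ w) (suc i) = e ◅ take w i

drop : (w : Walk H a b k) (i : Fin (suc k)) → Walk H (vertex w i) b (k ∸ toℕ i)
drop w       zero    = w
drop (_ ◅ w) (suc i) = drop w i

shortcut : (w : Walk H a b k) {i j : Fin (suc k)} → toℕ i < toℕ j → vertex w i ≡ vertex w j →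
           ∃ λ l → l < k × Walk H a b l
shortcut {H = H} {b = b} {k = k} w {i} {j} i<j same =
  toℕ i + (k ∸ toℕ j) , shorter , take w i ◅◅ subst (λ v → Walk H v b (k ∸ toℕ j)) (sym same) (drop w j)
  where
    shorter : toℕ i + (k ∸ toℕ j) < k
    shorter = begin-strict
      toℕ i + (k ∸ toℕ j) <⟨ +-monoˡ-< (k ∸ toℕ j) i<j ⟩
      toℕ j + (k ∸ toℕ j) ≡⟨ m+[n∸m]≡n (s≤s⁻¹ (toℕ<n j)) ⟩
      k                   ∎
      where open ≤-Reasoning

Geodesic : BoolRel N → Fin N → Fin N → ℕ → Set
Geodesic H a b k = Walk H a b k × (∀ {j} → j < k → ¬ Walk H a b j)

geodesic-vertex-injective : (g : Geodesic H a b k) → Injective _≡_ _≡_ (vertex (proj₁ g))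
geodesic-vertex-injective (w , minimal) {i} {j} same with <-cmp (toℕ i) (toℕ j)
... | tri< i<j _ _ = let (_ , l<k , w′) = shortcut w i<j same       in contradiction w′ (minimal l<k)
... | tri≈ _ i≡j _ = toℕ-injective i≡j
... | tri> _ _ j<i = let (_ , l<k , w′) = shortcut w j<i (sym same) in contradiction w′ (minimal l<k)

geodesic-short : ∀ {N} {H : BoolRel N} {a b k} → Geodesic H a b k → k < N
geodesic-short g = injective⇒≤ (geodesic-vertex-injective g)

search-geodesic : ∀ default L → Walk H a b k → k < L →
  let found = searchFirst (λ j → hasWalk H j a b) default (upTo L)
  in found ≤ k × Geodesic H a b found
search-geodesic {H = H} {a = a} {b = b} default L w k<L
  with searchFirst-hit (λ j → hasWalk H j a b) default id L k<L (Walk⇒hasWalk w)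
... | j , j≤k , found≡j , hit , misses rewrite found≡j =
  j≤k , hasWalk⇒Walk j a b hit , λ j′<j w′ → contradiction (trans (sym (misses j′<j)) (Walk⇒hasWalk w′)) λ ()

shortest : Walk H a b k → ∃ λ j → j ≤ k × Geodesic H a b j
shortest w = _ , search-geodesic 0 _ w ≤-refl

infixl 6 _∖_

-- Opaque so that H and z can be inferred from H ∖ z; it is the relation
-- whose walks reachAvoid searches (reachAvoid-∖).
opaque
  _∖_ : BoolRel N → Fin N → BoolRel N
  (H ∖ z) a b = H a b ∧ not (does (a ≟ z)) ∧ not (does (b ≟ z))

opaque
  unfolding _∖_

  ∖-intro : H a b ≡ true → a ≢ z → b ≢ z → (H ∖ z) a b ≡ true
  ∖-intro {a = a} {b = b} {z = z} a—b a≢z b≢z with a ≟ z | b ≟ z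
  ... | yes a≡z | _       = contradiction a≡z a≢z
  ... | no _    | yes b≡z = contradiction b≡z b≢z
  ... | no _    | no _    = cong (_∧ true) a—b

  ∖-elim : (H ∖ z) a b ≡ true → H a b ≡ true × a ≢ z × b ≢ z
  ∖-elim {H = H} {z = z} {a = a} {b = b} a—b with H a b | a ≟ z | b ≟ z
  ... | true | no a≢z | no b≢z = refl , a≢z , b≢z

  ∖-sym : (∀ x y → H x y ≡ H y x) → ∀ x y → (H ∖ z) x y ≡ (H ∖ z) y x
  ∖-sym {H = H} {z = z} H-sym x y rewrite H-sym x y = cong (H y x ∧_) (∧-comm (not (does (x ≟ z))) _)

  reachAvoid-∖ : ∀ G (v a b : Fin (n G)) → reachAvoid G v a b ≡ any (λ k → hasWalk (E G ∖ v) k a b) (upTo (n G))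
  reachAvoid-∖ G v a b = refl

∖-⊆ : (H ∖ z) a b ≡ true → H a b ≡ true
∖-⊆ = proj₁ ∘ ∖-elim

∖∖-⊆ : (H ∖ v ∖ z) a b ≡ true → (H ∖ z) a b ≡ true
∖∖-⊆ a—b = let (a—b′ , a≢z , b≢z) = ∖-elim a—b in ∖-intro (∖-⊆ a—b′) a≢z b≢z

vertex-avoids : (w : Walk (H ∖ z) a b k) → a ≢ z → ∀ i → vertex w i ≢ z
vertex-avoids w       a≢z zero    = a≢z
vertex-avoids (e ◅ w) _   (suc i) = vertex-avoids w (proj₂ (proj₂ (∖-elim e))) i

Through : BoolRel N → Fin N → Fin N → Fin N → ℕ → Set
Through H z a b k = ∃₂ λ i j → i + j ≡ k × Walk H a z i × Walk H z b j

split-at : ∀ z → Walk H a b k → Walk (H ∖ z) a b k ⊎ Through H z a b k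
split-at {a = a} z w with a ≟ z
... | yes refl = inj₂ (0 , _ , refl , ε , w)
split-at z ε                 | no _ = inj₁ ε
split-at z (_◅_ {b = c} e w) | no a≢z with c ≟ z
... | yes refl = inj₂ (1 , _ , refl , e ◅ ε , w)
... | no c≢z with split-at z w
...   | inj₁ w′                       = inj₁ (∖-intro e a≢z c≢z ◅ w′)
...   | inj₂ (i , j , i+j≡ , w₁ , w₂) = inj₂ (suc i , j , cong suc i+j≡ , e ◅ w₁ , w₂)

neighbour-towards : Walk H z u k → u ≢ z → ∃ λ w → H z w ≡ true × Reachable (H ∖ z) w u
neighbour-towards w u≢z with shortest w
... | zero , _ , ε , _ = contradiction refl u≢z
... | suc l , _ , _◅_ {b = w} z—w rest , minimal with split-at _ rest
...   | inj₁ rest′ = w , z—w , l , rest′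
...   | inj₂ (i , j , i+j≡l , _ , back) = contradiction back (minimal (s≤s (subst (j ≤_) i+j≡l (m≤n+m j i))))

-- Branches at a vertex

WeakAdj : (G : Graph) → Fin (n G) → Fin (n G) → Set
WeakAdj G a b = a ≡ b ⊎ E G a b ≡ true

module Components (G : Graph) where

  V : Set
  V = Fin (n G)

  infix 4 _~⟨_⟩_

  -- Same branch at z, i.e. component of G − z; z ~⟨ z ⟩ z holds by the empty
  -- walk, while z ~⟨ z ⟩ b fails for b ≢ z (~-avoids).
  _~⟨_⟩_ : V → V → V → Set
  a ~⟨ z ⟩ b = Reachable (E G ∖ z) a b

  edge⇒≢ : ∀ {a b} → E G a b ≡ true → a ≢ b
  edge⇒≢ {a} a—b refl = contradiction (trans (sym a—b) (irrefl G a)) λ ()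

  ~-refl : ∀ {a z} → a ~⟨ z ⟩ a
  ~-refl = 0 , ε

  ~-sym : ∀ {a b z} → a ~⟨ z ⟩ b → b ~⟨ z ⟩ a
  ~-sym (k , w) = k , reverseʷ (∖-sym (E-sym G)) w

  ~-trans : ∀ {a b c z} → a ~⟨ z ⟩ b → b ~⟨ z ⟩ c → a ~⟨ z ⟩ c
  ~-trans (_ , w) (_ , w′) = _ , w ◅◅ w′

  ~-step : ∀ {a b z} → WeakAdj G a b → a ≢ z → b ≢ z → a ~⟨ z ⟩ b
  ~-step (inj₁ refl) _   _   = ~-refl
  ~-step (inj₂ a—b)  a≢z b≢z = 1 , ∖-intro a—b a≢z b≢z ◅ ε

  ~-avoids : ∀ {a b z} → a ~⟨ z ⟩ b → b ≢ z → a ≢ z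
  ~-avoids (_ , ε)     b≢z = b≢z
  ~-avoids (_ , e ◅ _) _   = proj₁ (proj₂ (∖-elim e))

  ~-advance : ∀ {a b c z} → WeakAdj G a b → b ≢ z → a ~⟨ z ⟩ c → c ≢ z → b ~⟨ z ⟩ c
  ~-advance a≈b b≢z a~c c≢z = ~-trans (~-sym (~-step a≈b (~-avoids a~c c≢z) b≢z)) a~c

  ~-split : ∀ {a b x z} → a ~⟨ x ⟩ b → a ~⟨ z ⟩ b ⊎ (a ~⟨ x ⟩ z × z ~⟨ x ⟩ b)
  ~-split {z = z} (k , w) with split-at z w
  ... | inj₁ w′                     = inj₁ (k , mapʷ ∖∖-⊆ w′)
  ... | inj₂ (_ , _ , _ , w₁ , w₂) = inj₂ ((_ , w₁) , (_ , w₂))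

  ~⇒reachAvoid : ∀ {a b z} → a ~⟨ z ⟩ b → reachAvoid G z a b ≡ true
  ~⇒reachAvoid {a} {b} {z} (_ , w) with shortest w
  ... | _ , _ , g = trans (reachAvoid-∖ G z a b)
                      (any-≡true⁺ _ (∈-upTo⁺ (geodesic-short g)) (Walk⇒hasWalk (proj₁ g)))

  reachAvoid⇒~ : ∀ {a b z} → reachAvoid G z a b ≡ true → a ~⟨ z ⟩ b
  reachAvoid⇒~ {a} {b} {z} found
    with any-≡true⁻ (λ k → hasWalk (E G ∖ z) k a b) (upTo (n G)) (trans (sym (reachAvoid-∖ G z a b)) found)
  ... | k , _ , hit = k , hasWalk⇒Walk k a b hit

  _~?⟨_⟩_ : ∀ a z b → Dec (a ~⟨ z ⟩ b)
  a ~?⟨ z ⟩ b = map′ reachAvoid⇒~ ~⇒reachAvoid (reachAvoid G z a b Bool.≟ true)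

  closing-cycle : ∀ {a b z k} → E G z a ≡ true → E G z b ≡ true → Geodesic (E G ∖ z) a b (suc k) → Cycle G
  closing-cycle {a} {b} {z} {k} z—a z—b g@(path , _) = record
    { k = k ; c = cycle ; inj = cycle-injective ; steps = cycle-steps ; close = cycle-close }
    where
      cycle : Fin (suc (suc (suc k))) → V
      cycle zero    = z
      cycle (suc i) = vertex path i

      avoids-z : ∀ i → vertex path i ≢ z
      avoids-z = vertex-avoids path (edge⇒≢ z—a ∘ sym)

      cycle-injective : ∀ i j → cycle i ≡ cycle j → i ≡ j
      cycle-injective zero    zero    _  = refl
      cycle-injective zero    (suc j) eq = contradiction (sym eq) (avoids-z j)
      cycle-injective (suc i) zero    eq = contradiction eq (avoids-z i)
      cycle-injective (suc i) (suc j) eq = cong suc (geodesic-vertex-injective g eq)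

      cycle-steps : ∀ i → E G (cycle (inject₁ i)) (cycle (suc i)) ≡ true
      cycle-steps zero    = z—a
      cycle-steps (suc i) = ∖-⊆ (vertex-step path i)

      cycle-close : E G (cycle (fromℕ (suc (suc k)))) z ≡ true
      cycle-close = subst (λ v → E G v z ≡ true) (sym (vertex-last path)) (trans (E-sym G b z) z—b)

-- Distances and triods

module Distance (G : Graph) (connected : Connected G) where

  open Components G

  d : V → V → ℕ
  d = dist G

  -- dist G x y unfolds to searchFirst (λ k → hasWalk (E G) k x y) (n G) (upTo (suc (n G))).
  dist-from-walk : ∀ {x y k} → Walk (E G) x y k → d x y ≤ k × Geodesic (E G) x y (d x y)
  dist-from-walk w with shortest w
  ... | j , j≤k , g with search-geodesic (n G) (suc (n G)) (proj₁ g) (m<n⇒m<1+n (geodesic-short g))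
  ...   | d≤j , geodesic = ≤-trans d≤j j≤k , geodesic

  dist-minimal : ∀ {x y k} → Walk (E G) x y k → d x y ≤ k
  dist-minimal = proj₁ ∘ dist-from-walk

  dist-geodesic : ∀ x y → Geodesic (E G) x y (d x y)
  dist-geodesic x y = let (k , found) = connected x y in proj₂ (dist-from-walk (hasWalk⇒Walk k x y found))

  dist-refl : ∀ {x} → d x x ≡ 0
  dist-refl = n≤0⇒n≡0 (dist-minimal ε)

  dist>0⇒≢ : ∀ {x y} → 0 < d x y → x ≢ y
  dist>0⇒≢ 0<d refl = <-irrefl (sym dist-refl) 0<d

  dist-sym : ∀ x y → d x y ≡ d y x
  dist-sym x y = ≤-antisym (d-sym≤ x y) (d-sym≤ y x)
    where
      d-sym≤ : ∀ x y → d x y ≤ d y x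
      d-sym≤ x y = dist-minimal (reverseʷ (E-sym G) (proj₁ (dist-geodesic y x)))

  dist-triangle : ∀ x y z → d x z ≤ d x y + d y z
  dist-triangle x y z = dist-minimal (proj₁ (dist-geodesic x y) ◅◅ proj₁ (dist-geodesic y z))

  dist-weakAdj : ∀ {x y} → WeakAdj G x y → d x y ≤ 1
  dist-weakAdj (inj₁ refl) = ≤-trans (≤-reflexive dist-refl) z≤n
  dist-weakAdj (inj₂ x—y)  = dist-minimal (x—y ◅ ε)

  dist-separated : ∀ {a b z} → ¬ a ~⟨ z ⟩ b → d a b ≡ d a z + d z b
  dist-separated {a} {b} {z} a≁b with split-at z (proj₁ (dist-geodesic a b))
  ... | inj₁ w = contradiction (_ , w) a≁b
  ... | inj₂ (i , j , i+j≡d , w₁ , w₂) =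
    ≤-antisym (dist-triangle a z b) (subst (d a z + d z b ≤_) i+j≡d (+-mono-≤ (dist-minimal w₁) (dist-minimal w₂)))

  branch-neighbour : ∀ {u z} → u ≢ z → ∃ λ w → E G z w ≡ true × w ~⟨ z ⟩ u
  branch-neighbour {u} {z} = neighbour-towards (proj₁ (dist-geodesic z u))

  module _ {p r : V} (r-farthest : ∀ y → d y p ≤ d r p) where

    farthest-beyond-separator : ∀ {u z} → ¬ u ~⟨ z ⟩ p → d z u ≤ d z r
    farthest-beyond-separator {u} {z} u≁p = +-cancelʳ-≤ (d z p) (d z u) (d z r) (begin
      d z u + d z p ≡⟨ cong (_+ d z p) (dist-sym z u) ⟩
      d u z + d z p ≡⟨ dist-separated u≁p ⟨
      d u p         ≤⟨ r-farthest u ⟩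
      d r p         ≤⟨ dist-triangle r z p ⟩
      d r z + d z p ≡⟨ cong (_+ d z p) (dist-sym r z) ⟩
      d z r + d z p ∎)
      where open ≤-Reasoning

    farthest-beyond-separated-pair : ∀ {x y z} → ¬ x ~⟨ z ⟩ y → d z x ≤ d z r ⊎ d z y ≤ d z r
    farthest-beyond-separated-pair {x} {y} {z} x≁y with x ~?⟨ z ⟩ p
    ... | no  x≁p = inj₁ (farthest-beyond-separator x≁p)
    ... | yes x~p = inj₂ (farthest-beyond-separator λ y~p → x≁y (~-trans x~p (~-sym y~p)))

  record Triod (s : ℕ) : Set where
    field
      centre         : V
      leg₁ leg₂ leg₃ : V
      leg₁≁leg₂      : ¬ leg₁ ~⟨ centre ⟩ leg₂
      leg₁≁leg₃      : ¬ leg₁ ~⟨ centre ⟩ leg₃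
      leg₂≁leg₃      : ¬ leg₂ ~⟨ centre ⟩ leg₃
      long₁          : s ≤ d centre leg₁
      long₂          : s ≤ d centre leg₂
      long₃          : s ≤ d centre leg₃

  open Triod

  reach-lower : ∀ {w z u} → w ~⟨ z ⟩ u → d z u ≤ reach G z w
  reach-lower {w} {z} {u} w~u =
    subst (λ found → (if found then d z u else 0) ≤ reach G z w) (~⇒reachAvoid w~u)
      (maxList-upper (∈-map⁺ (λ u′ → if reachAvoid G z w u′ then d z u′ else 0) (∈-allFin u)))

  longBranches : ℕ → V → List V
  longBranches s z = filter ((s ≤?_) ∘ reach G z) (neighbours G z)

  leg-in-long-branch : ∀ {s z u} → 0 < s → s ≤ d z u → ∃ λ w → w ∈ longBranches s z × w ~⟨ z ⟩ u
  leg-in-long-branch {s} {z} {u} 0<s s≤d with branch-neighbour (dist>0⇒≢ (<-≤-trans 0<s s≤d) ∘ sym)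
  ... | w , z—w , w~u =
    w , ∈-filter⁺ ((s ≤?_) ∘ reach G z) (∈-filter⁺ (Bool.T? ∘ E G z) (∈-allFin w) (Equivalence.from T-≡ z—w))
                  (≤-trans s≤d (reach-lower w~u)) , w~u

  branches-distinct : ∀ {w w′ u u′ z} → w ~⟨ z ⟩ u → w′ ~⟨ z ⟩ u′ → ¬ u ~⟨ z ⟩ u′ → w ≢ w′
  branches-distinct w~u w′~u′ u≁u′ refl = u≁u′ (~-trans (~-sym w~u) w′~u′)

  InLongBranch : ℕ → V → V → Set
  InLongBranch s z u = ∃ λ w → w ∈ longBranches s z × w ~⟨ z ⟩ u

  three-long-branches : ∀ {s z u₁ u₂ u₃} → ¬ u₁ ~⟨ z ⟩ u₂ → ¬ u₁ ~⟨ z ⟩ u₃ → ¬ u₂ ~⟨ z ⟩ u₃ →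
                        InLongBranch s z u₁ → InLongBranch s z u₂ → InLongBranch s z u₃ →
                        3 ≤ length (longBranches s z)
  three-long-branches {s} {z} u₁≁u₂ u₁≁u₃ u₂≁u₃ (w₁ , w₁∈ , w₁~u₁) (w₂ , w₂∈ , w₂~u₂) (w₃ , w₃∈ , w₃~u₃) =
    distinct-members⇒≤length (triple w₁ w₂ w₃)
      (triple-injective (branches-distinct w₁~u₁ w₂~u₂ u₁≁u₂)
                        (branches-distinct w₁~u₁ w₃~u₃ u₁≁u₃)
                        (branches-distinct w₂~u₂ w₃~u₃ u₂≁u₃))
      members
    where
      members : ∀ i → triple w₁ w₂ w₃ i ∈ longBranches s z
      members zero             = w₁∈
      members (suc zero)       = w₂∈
      members (suc (suc zero)) = w₃∈

  triod⇒eta : ∀ {s} → 0 < s → (τ : Triod s) → s ≤ eta G (centre τ)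
  triod⇒eta {s} 0<s τ =
    third-largest s (map (reach G (centre τ)) (neighbours G (centre τ)))
      (subst (3 ≤_) (sym (length-filter-map (s ≤?_) (reach G (centre τ)) (neighbours G (centre τ))))
        (three-long-branches (leg₁≁leg₂ τ) (leg₁≁leg₃ τ) (leg₂≁leg₃ τ)
                    (leg-in-long-branch 0<s (long₁ τ)) (leg-in-long-branch 0<s (long₂ τ)) (leg-in-long-branch 0<s (long₃ τ))))

  triod⇒triodSize : ∀ {s} → Triod s → s ≤ triodSize G
  triod⇒triodSize {zero}  _ = z≤n
  triod⇒triodSize {suc s} τ =
    ≤-trans (triod⇒eta (s≤s z≤n) τ) (maxList-upper (∈-map⁺ (eta G) (∈-allFin (centre τ))))

-- Weak homomorphisms from paths

clamp : ∀ m → ℕ → Fin (suc m)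
clamp m t = fromℕ< (s≤s (m⊓n≤n t m))

toℕ-clamp : ∀ m t → toℕ (clamp m t) ≡ t ⊓ m
toℕ-clamp m t = toℕ-fromℕ< (s≤s (m⊓n≤n t m))

clamp-toℕ : (i : Fin (suc m)) → clamp m (toℕ i) ≡ i
clamp-toℕ {m} i = toℕ-injective (trans (toℕ-clamp m (toℕ i)) (m≤n⇒m⊓n≡m (s≤s⁻¹ (toℕ<n i))))

clamp-step : ∀ m t → clamp m t ≡ clamp m (suc t) ⊎ toℕ (clamp m (suc t)) ≡ suc (toℕ (clamp m t))
clamp-step m t with t <? m
... | yes t<m = inj₂ (begin
  toℕ (clamp m (suc t)) ≡⟨ toℕ-clamp m (suc t) ⟩
  suc t ⊓ m             ≡⟨ m≤n⇒m⊓n≡m t<m ⟩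
  suc t                 ≡⟨ cong suc (m≤n⇒m⊓n≡m (<⇒≤ t<m)) ⟨
  suc (t ⊓ m)           ≡⟨ cong suc (toℕ-clamp m t) ⟨
  suc (toℕ (clamp m t)) ∎)
  where open ≡-Reasoning
... | no t≮m = inj₁ (toℕ-injective (begin
  toℕ (clamp m t)       ≡⟨ toℕ-clamp m t ⟩
  t ⊓ m                 ≡⟨ m≥n⇒m⊓n≡n (≮⇒≥ t≮m) ⟩
  m                     ≡⟨ m≥n⇒m⊓n≡n (m≤n⇒m≤1+n (≮⇒≥ t≮m)) ⟨
  suc t ⊓ m             ≡⟨ toℕ-clamp m (suc t) ⟨
  toℕ (clamp m (suc t)) ∎))
  where open ≡-Reasoning

pathE-next : {i j : Fin (suc m)} → toℕ j ≡ suc (toℕ i) → pathE m i j ≡ true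
pathE-next {i = i} j≡i+1 rewrite j≡i+1 | Equivalence.to T-≡ (≡⇒≡ᵇ (toℕ i) (toℕ i) refl) = refl

weakHom-step : ∀ H {h : Fin (suc m) → Fin (n H)} → WeakHom (PathGraph m) H h →
               ∀ t → WeakAdj H (h (clamp m t)) (h (clamp m (suc t)))
weakHom-step {m} H {h} hom t with clamp-step m t
... | inj₁ same = inj₁ (cong h same)
... | inj₂ next = hom _ _ (pathE-next next)

-- Trees

module Tree (G : Graph) (connected : Connected G) (acyclic : Acyclic G) where

  open Components G
  open Distance G connected

  branch-neighbour-unique : ∀ {z w₁ w₂} → E G z w₁ ≡ true → E G z w₂ ≡ true → w₁ ~⟨ z ⟩ w₂ → w₁ ≡ w₂
  branch-neighbour-unique z—w₁ z—w₂ (_ , w) with shortest w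
  ... | zero  , _ , ε , _ = refl
  ... | suc _ , _ , g     = contradiction (closing-cycle z—w₁ z—w₂ g) acyclic

  neighbour-separates-branch : ∀ {z x b} → E G z x ≡ true → x ~⟨ z ⟩ b → b ≢ z → ¬ z ~⟨ x ⟩ b
  neighbour-separates-branch z—x x~b b≢z (_ , z⇝b) with neighbour-towards z⇝b b≢z
  ... | w , z—w , (_ , w⇝b) =
    let (z—w′ , _ , w≢x) = ∖-elim z—w
    in w≢x (sym (branch-neighbour-unique z—x z—w′ (~-trans x~b (~-sym (_ , mapʷ ∖∖-⊆ w⇝b)))))

  module Chase {s} (2≤s : 2 ≤ s) {f g : ℕ → V}
               (f-step : ∀ t → WeakAdj G (f t) (f (suc t))) (g-step : ∀ t → WeakAdj G (g t) (g (suc t)))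
               (apart : ∀ t → s ≤ d (f t) (g t))
               {p r : V} (r-farthest : ∀ y → d y p ≤ d r p) where

    far⇒≢ : ∀ {a b} → s ≤ d a b → a ≢ b
    far⇒≢ s≤d = dist>0⇒≢ (≤-trans (s≤s z≤n) (≤-trans 2≤s s≤d))

    Separates : ℕ → Set
    Separates t = ¬ g t ~⟨ f t ⟩ r

    separates? : ∀ t → Dec (Separates t)
    separates? t = ¬? (g t ~?⟨ f t ⟩ r)

    module AfterLastSeparation {ta t₁} (ta<t₁ : ta < t₁) (sep : Separates ta)
                               (later : ∀ {t} → ta < t → t ≤ t₁ → ¬ Separates t) (g-end : g t₁ ≡ r) where

      pivot x₁ y₀ y₁ : V
      pivot = f ta
      x₁    = f (suc ta)
      y₀    = g ta
      y₁    = g (suc ta)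

      y₁≢pivot : y₁ ≢ pivot
      y₁≢pivot y₁≡pivot = contradiction (≤-trans 2≤s (≤-trans (apart ta) d≤1)) λ { (s≤s ()) }
        where
          d≤1 : d pivot y₀ ≤ 1
          d≤1 = subst (λ v → d v y₀ ≤ 1) y₁≡pivot (subst (_≤ 1) (dist-sym y₀ y₁) (dist-weakAdj (g-step ta)))

      y₀~y₁ : y₀ ~⟨ pivot ⟩ y₁
      y₀~y₁ = ~-step (g-step ta) (far⇒≢ (apart ta) ∘ sym) y₁≢pivot

      y₁≁r : ¬ y₁ ~⟨ pivot ⟩ r
      y₁≁r y₁~r = sep (~-trans y₀~y₁ y₁~r)

      y₁~r : y₁ ~⟨ x₁ ⟩ r
      y₁~r = decidable-stable (y₁ ~?⟨ x₁ ⟩ r) (later ≤-refl ta<t₁)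

      x₁≢pivot : x₁ ≢ pivot
      x₁≢pivot x₁≡pivot = y₁≁r (subst (λ v → y₁ ~⟨ v ⟩ r) x₁≡pivot y₁~r)

      pivot—x₁ : E G pivot x₁ ≡ true
      pivot—x₁ with f-step ta
      ... | inj₁ pivot≡x₁ = contradiction (sym pivot≡x₁) x₁≢pivot
      ... | inj₂ pivot—x₁ = pivot—x₁

      y₁~pivot~r : y₁ ~⟨ x₁ ⟩ pivot × pivot ~⟨ x₁ ⟩ r
      y₁~pivot~r with ~-split y₁~r
      ... | inj₁ y₁~r-avoiding-pivot = contradiction y₁~r-avoiding-pivot y₁≁r
      ... | inj₂ through-pivot       = through-pivot

      x₁≁y₁ : ¬ x₁ ~⟨ pivot ⟩ y₁
      x₁≁y₁ x₁~y₁ = neighbour-separates-branch pivot—x₁ x₁~y₁ y₁≢pivot (~-sym (proj₁ y₁~pivot~r))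

      x₁≁r : pivot ≢ r → ¬ x₁ ~⟨ pivot ⟩ r
      x₁≁r pivot≢r x₁~r = neighbour-separates-branch pivot—x₁ x₁~r (pivot≢r ∘ sym) (proj₂ y₁~pivot~r)

      Invariant : ℕ → Set
      Invariant t = f t ~⟨ pivot ⟩ x₁ × g t ~⟨ pivot ⟩ y₁

      triod-at : ∀ {t} → Invariant t → g (suc t) ≡ pivot → Triod s
      triod-at {t} (ft~x₁ , _) g≡pivot = record
        { centre = pivot ; leg₁ = y₀ ; leg₂ = x ; leg₃ = r
        ; leg₁≁leg₂ = y₀≁x ; leg₁≁leg₃ = sep ; leg₂≁leg₃ = λ x~r → x₁≁r (far⇒≢ long-r) (~-trans (~-sym x~x₁) x~r)
        ; long₁ = apart ta ; long₂ = long-x ; long₃ = long-r }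
        where
          x : V
          x = f (suc t)

          x~x₁ : x ~⟨ pivot ⟩ x₁
          x~x₁ = ~-advance (f-step t) (λ x≡pivot → far⇒≢ (apart (suc t)) (trans x≡pivot (sym g≡pivot))) ft~x₁ x₁≢pivot

          y₀≁x : ¬ y₀ ~⟨ pivot ⟩ x
          y₀≁x y₀~x = x₁≁y₁ (~-trans (~-sym x~x₁) (~-trans (~-sym y₀~x) y₀~y₁))

          long-x : s ≤ d pivot x
          long-x = subst (s ≤_) (trans (cong (d x) g≡pivot) (dist-sym x pivot)) (apart (suc t))

          long-r : s ≤ d pivot r
          long-r = [ ≤-trans (apart ta) , ≤-trans long-x ]′ (farthest-beyond-separated-pair r-farthest y₀≁x)

      step : ∀ {t} → ta < suc t → suc t ≤ t₁ → Invariant t → Invariant (suc t) ⊎ Triod s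
      step {t} ta<t+1 t+1≤t₁ inv@(ft~x₁ , gt~y₁) with f (suc t) ≟ pivot | g (suc t) ≟ pivot
      ... | _           | yes g≡pivot = inj₂ (triod-at inv g≡pivot)
      ... | yes f≡pivot | no  g≢pivot = contradiction separated (later ta<t+1 t+1≤t₁)
        where
          separated : Separates (suc t)
          separated g~r = y₁≁r (~-trans (~-sym (~-advance (g-step t) g≢pivot gt~y₁ y₁≢pivot))
                                        (subst (λ v → g (suc t) ~⟨ v ⟩ r) f≡pivot g~r))
      ... | no  f≢pivot | no  g≢pivot =
        inj₁ (~-advance (f-step t) f≢pivot ft~x₁ x₁≢pivot , ~-advance (g-step t) g≢pivot gt~y₁ y₁≢pivot)

      invariant : ∀ t → ta < t → t ≤ t₁ → Invariant t ⊎ Triod s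
      invariant (suc t) ta<t+1 t+1≤t₁ with m≤n⇒m<n∨m≡n (s≤s⁻¹ ta<t+1)
      ... | inj₂ refl = inj₁ (~-refl , ~-refl)
      ... | inj₁ ta<t = [ step ta<t+1 t+1≤t₁ , inj₂ ]′ (invariant t ta<t (≤-trans (n≤1+n t) t+1≤t₁))

      triod : Triod s
      triod with invariant t₁ ta<t₁ ≤-refl
      ... | inj₂ τ            = τ
      ... | inj₁ (_ , gt₁~y₁) = contradiction (~-sym (subst (λ v → v ~⟨ pivot ⟩ y₁) g-end gt₁~y₁)) y₁≁r

    triod-from-meeting : ∀ {t₀ t₁} → f t₀ ≡ r → g t₁ ≡ r → t₀ ≤ t₁ → Triod s
    triod-from-meeting {t₀} {t₁} f-start g-end t₀≤t₁
      with lastBefore separates? separated-at-start merged-at-end t₀≤t₁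
      where
        separated-at-start : Separates t₀
        separated-at-start gt₀~r =
          ~-avoids (~-sym gt₀~r) (far⇒≢ (apart t₀) ∘ sym) (sym f-start)
        merged-at-end : ¬ Separates t₁
        merged-at-end separated = separated (subst (λ v → g t₁ ~⟨ f t₁ ⟩ v) g-end ~-refl)
    ... | ta , ta<t₁ , sep , later = AfterLastSeparation.triod ta<t₁ sep later g-end

  svs-witness⇒triod : ∀ {s m} {f g : Fin (suc m) → V} → 2 ≤ s →
                      WeakHom (PathGraph m) G f → Surjective f → WeakHom (PathGraph m) G g → Surjective g →
                      mP m G f g ≡ s → Triod s
  svs-witness⇒triod {s} {m} {f} {g} 2≤s f-hom f-onto g-hom g-onto mP≡s = meet (f-onto r) (g-onto r)
    where
      p r : V
      p = f zero
      r = argmax (λ y → d y p) p (allFin (n G))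

      r-farthest : ∀ y → d y p ≤ d r p
      r-farthest y = All.lookup (f[xs]≤f[argmax] p (allFin (n G))) (∈-allFin y)

      apart : ∀ t → s ≤ d (f (clamp m t)) (g (clamp m t))
      apart t = subst (_≤ _) mP≡s (minFin-lower _ (clamp m t))

      meet : (∃ λ i → f i ≡ r) → (∃ λ j → g j ≡ r) → Triod s
      meet (i , fi≡r) (j , gj≡r) with ≤-total (toℕ i) (toℕ j)
      ... | inj₁ i≤j = Chase.triod-from-meeting 2≤s (weakHom-step G f-hom) (weakHom-step G g-hom) apart r-farthest
                         (trans (cong f (clamp-toℕ i)) fi≡r) (trans (cong g (clamp-toℕ j)) gj≡r) i≤j
      ... | inj₂ j≤i = Chase.triod-from-meeting 2≤s (weakHom-step G g-hom) (weakHom-step G f-hom)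
                         (λ t → subst (s ≤_) (dist-sym _ _) (apart t)) r-farthest
                         (trans (cong g (clamp-toℕ j)) gj≡r) (trans (cong f (clamp-toℕ i)) fi≡r) j≤i

theorem2p3 : (T : Graph) → IsTree T → (s : ℕ) → IsSvs T s → 2 ≤ s → s ≤ triodSize T
theorem2p3 T (_ , connected , acyclic) s ((_ , _ , _ , f-hom , f-onto , g-hom , g-onto , mP≡s) , _) 2≤s =
  Distance.triod⇒triodSize T connected (Tree.svs-witness⇒triod T connected acyclic 2≤s f-hom f-onto g-hom g-onto mP≡s)
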